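{- Let $(G,w,\ell)$ be an instance of \textsc{Annotated Min-Power Symmetric Connectivity} with $G=(V,E)$. Let $P=(v_0,v_1,\dots,v_h)$ be a path in $G$ with $h>8$ such that $\deg(v_0)>2$, $\deg(v_h)>2$ and $\deg(v_j)=2$ for $1\le j\le h-1$. Let $\{v_i,v_{i+1}\}$ and $\{v_k,v_{k+1}\}$ be two edges of $P$ with $i,k\notin\{0,h-1\}$ and $\beta(\{v_i,v_{i+1}\})\ge\beta(\{v_k,v_{k+1}\})$. Let $T=(V,F)$ be an optimal solution that does not contain $\{v_k,v_{k+1}\}$. Then $T'=(V,(F\cup\{\{v_k,v_{k+1}\}\})\setminus\{\{v_i,v_{i+1}\}\})$ is a connected spanning subgraph of $G$ and its cost is at most the cost of $T$.
   Context: \textsc{Annotated Min-Power Symmetric Connectivity}: given a connected graph $G=(V,E)$, weights $w\colon E\to\mathbb{N}$ and annotations $\ell\colon V\to\mathbb{N}$, a solution is a connected spanning subgraph $T=(V,F)$ with cost $\sum_{v\in V}\max\{\ell(v),\max_{\{u,v\}\in F}w(\{u,v\})\}$, to be minimized. For a path $P$ as in the claim and $1\le j\le h-2$, the benefit of the edge $\{v_j,v_{j+1}\}$ is $\beta(\{v_j,v_{j+1}\}):=\max\{0,\,w(\{v_j,v_{j+1}\})-\max\{\ell(v_j),w(\{v_{j-1},v_j\})\}\}+\max\{0,\,w(\{v_j,v_{j+1}\})-\max\{\ell(v_{j+1}),w(\{v_{j+1},v_{j+2}\})\}\}$. -}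

module Defs where

open import Data.Nat using (ℕ; zero; suc; _+_; _∸_; _⊔_; _≤_; _<_)
open import Data.Fin using (Fin; _≟_)
open import Data.Bool using (Bool; true; false; if_then_else_; _∧_; _∨_)
open import Data.List using (List; foldr; map; allFin)
open import Data.Nat.ListAction using (sum)
open import Data.Product using (_×_)
open import Relation.Binary.PropositionalEquality using (_≡_; _≢_)
open import Relation.Nullary.Decidable using (⌊_⌋)

IsSimpleGraph : {n : ℕ} → (Fin n → Fin n → Bool) → Set
IsSimpleGraph {n} E =
  ((u v : Fin n) → E u v ≡ E v u) × ((u : Fin n) → E u u ≡ false)

data Reachable {n : ℕ} (F : Fin n → Fin n → Bool) : Fin n → Fin n → Set where
  here : ∀ {u} → Reachable F u u
  step : ∀ {u v x} → F u v ≡ true → Reachable F v x → Reachable F u x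

Connected : {n : ℕ} → (Fin n → Fin n → Bool) → Set
Connected {n} F = (u v : Fin n) → Reachable F u v

IsConnSpanningSubgraph : {n : ℕ} → (E F : Fin n → Fin n → Bool) → Set
IsConnSpanningSubgraph {n} E F =
  ((u v : Fin n) → F u v ≡ F v u) ×
  ((u v : Fin n) → F u v ≡ true → E u v ≡ true) ×
  Connected F

deg : {n : ℕ} → (Fin n → Fin n → Bool) → Fin n → ℕ
deg {n} E v = sum (map (λ u → if E v u then 1 else 0) (allFin n))

maxIncident : {n : ℕ} → (Fin n → Fin n → ℕ) → (Fin n → Fin n → Bool) → Fin n → ℕ
maxIncident {n} w F v = foldr _⊔_ 0 (map (λ u → if F v u then w v u else 0) (allFin n))

cost : {n : ℕ} → (Fin n → Fin n → ℕ) → (Fin n → ℕ) → (Fin n → Fin n → Bool) → ℕ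
cost {n} w ℓ F = sum (map (λ v → ℓ v ⊔ maxIncident w F v) (allFin n))

IsOptimal : {n : ℕ} → (Fin n → Fin n → Bool) → (Fin n → Fin n → ℕ) → (Fin n → ℕ) →
            (Fin n → Fin n → Bool) → Set
IsOptimal {n} E w ℓ F =
  IsConnSpanningSubgraph E F ×
  ((S : Fin n → Fin n → Bool) → IsConnSpanningSubgraph E S → cost w ℓ F ≤ cost w ℓ S)

isEdge : {n : ℕ} → Fin n → Fin n → Fin n → Fin n → Bool
isEdge a b u v = (⌊ u ≟ a ⌋ ∧ ⌊ v ≟ b ⌋) ∨ (⌊ u ≟ b ⌋ ∧ ⌊ v ≟ a ⌋)

swapEdge : {n : ℕ} → (Fin n → Fin n → Bool) → (a b a' b' : Fin n) → Fin n → Fin n → Bool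
swapEdge F a b a' b' u v =
  if isEdge a b u v then false else (if isEdge a' b' u v then true else F u v)

-- A path P = (p 0, …, p h) in G with distinct vertices (p is only
-- relevant on 0..h).
IsPath : {n : ℕ} → (Fin n → Fin n → Bool) → (ℕ → Fin n) → ℕ → Set
IsPath E p h =
  ((j : ℕ) → j < h → E (p j) (p (suc j)) ≡ true) ×
  ((j j' : ℕ) → j ≤ h → j' ≤ h → p j ≡ p j' → j ≡ j')

-- benefit of edge {p j, p (j+1)}, for 1 ≤ j ≤ h-2
β : {n : ℕ} → (Fin n → Fin n → ℕ) → (Fin n → ℕ) → (ℕ → Fin n) → ℕ → ℕ
β w ℓ p j =
  (w (p j) (p (suc j)) ∸ (ℓ (p j) ⊔ w (p (j ∸ 1)) (p j))) +
  (w (p j) (p (suc j)) ∸ (ℓ (p (suc j)) ⊔ w (p (suc j)) (p (suc (suc j)))))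

-- Write e_j for the path edge {v_j, v_(j+1)}. Interior vertices of P have degree 2, so a walk
-- can enter or leave a stretch of P only through its two end edges. Hence the connected
-- solution F, which lacks e_k, contains every other e_j (otherwise the stretch between the two
-- missing edges would be cut off), and F + e_k contains all of P. In a graph containing P the
-- endpoints of an interior edge e_j are incident to no other edges than e_(j-1), e_j, e_(j+1),
-- so deleting e_j lowers the cost by exactly β(e_j). Therefore
--   cost T' + β(e_i) = cost (F + e_k) = cost F + β(e_k) ≤ cost F + β(e_i).
-- For connectivity, an F-walk from v_k to v_(k+1) cannot avoid e_i (it would stay trapped
-- between e_i and e_k), and replacing its crossing of e_i by e_k links v_i to v_(i+1) in T'.

module Submission where

open import Defs
open import Data.Nat.Properties hiding (_≟_)
open import Algebra.Properties.CommutativeSemigroup +-commutativeSemigroup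
  using (xy∙z≈zy∙x; xy∙z≈xz∙y)
open import Data.Bool using (Bool; true; false; if_then_else_; _∧_; _∨_)
open import Data.Bool.Properties using (∧-comm; ∨-comm)
open import Data.Empty using (⊥-elim)
open import Data.Fin using (Fin; zero; suc; _≟_)
open import Data.Fin.Properties using () renaming (suc-injective to Fin-suc-injective)
open import Data.List using (foldr; tabulate; allFin)
open import Data.List.Properties using (map-tabulate; map-cong; tabulate-cong)
open import Data.Nat using (ℕ; zero; suc; _+_; _∸_; _⊔_; _≤_; _<_; z≤n; s≤s)
  renaming (_≟_ to _≟ℕ_)
open import Data.Nat.ListAction using (sum)
open import Data.Product using (_×_; _,_; proj₁; ∃-syntax)
open import Data.Sum using (_⊎_; inj₁; inj₂; [_,_]′; swap)
open import Data.Vec.Functional using (updateAt)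
open import Data.Vec.Functional.Properties using (updateAt-updates; updateAt-minimal)
open import Function using (id; const; _∘_)
open import Relation.Binary.Definitions using (tri<; tri≈; tri>)
open import Relation.Binary.PropositionalEquality
open import Relation.Nullary using (¬_; yes; no; contradiction)
open import Relation.Nullary.Decidable using (⌊_⌋; dec-true; isYes≗does)

m⊔n≡m+[n∸m] : ∀ m n → m ⊔ n ≡ m + (n ∸ m)
m⊔n≡m+[n∸m] m n with ≤-total m n
... | inj₁ m≤n = trans (m≤n⇒m⊔n≡n m≤n) (sym (m+[n∸m]≡n m≤n))
... | inj₂ n≤m = begin
  m ⊔ n        ≡⟨ m≥n⇒m⊔n≡m n≤m ⟩
  m            ≡⟨ +-identityʳ m ⟨
  m + 0        ≡⟨ cong (m +_) (m≤n⇒m∸n≡0 n≤m) ⟨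
  m + (n ∸ m)  ∎
  where open ≡-Reasoning

sum-tabulate-cong : ∀ {n} {f g : Fin n → ℕ} → (∀ v → f v ≡ g v) →
                    sum (tabulate f) ≡ sum (tabulate g)
sum-tabulate-cong f≗g = cong sum (tabulate-cong f≗g)

sum-tabulate-bump : ∀ {n} (f g : Fin n → ℕ) (a : Fin n) {x} →
                    (∀ v → v ≢ a → f v ≡ g v) → f a ≡ g a + x →
                    sum (tabulate f) ≡ sum (tabulate g) + x
sum-tabulate-bump {suc n} f g zero {x} off at = begin
  f zero + sum (tabulate (f ∘ suc))      ≡⟨ cong₂ _+_ at (sum-tabulate-cong (λ v → off (suc v) λ ())) ⟩
  g zero + x + sum (tabulate (g ∘ suc))  ≡⟨ xy∙z≈xz∙y (g zero) x _ ⟩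
  g zero + sum (tabulate (g ∘ suc)) + x  ∎
  where open ≡-Reasoning
sum-tabulate-bump {suc n} f g (suc a) {x} off at = begin
  f zero + sum (tabulate (f ∘ suc))        ≡⟨ cong₂ _+_ (off zero λ ()) tail-bump ⟩
  g zero + (sum (tabulate (g ∘ suc)) + x)  ≡⟨ +-assoc (g zero) _ x ⟨
  g zero + sum (tabulate (g ∘ suc)) + x    ∎
  where
  open ≡-Reasoning
  tail-bump : sum (tabulate (f ∘ suc)) ≡ sum (tabulate (g ∘ suc)) + x
  tail-bump = sum-tabulate-bump (f ∘ suc) (g ∘ suc) a
                (λ v v≢a → off (suc v) (v≢a ∘ Fin-suc-injective)) at

sum-tabulate-bump₂ : ∀ {n} (f g : Fin n → ℕ) {a b : Fin n} {x y} → a ≢ b →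
                     (∀ v → v ≢ a → v ≢ b → f v ≡ g v) → f a ≡ g a + x → f b ≡ g b + y →
                     sum (tabulate f) ≡ sum (tabulate g) + (x + y)
sum-tabulate-bump₂ f g {a} {b} {x} {y} a≢b off at-a at-b = begin
  sum (tabulate f)               ≡⟨ sum-tabulate-bump f m a off-a at-a′ ⟩
  sum (tabulate m) + x           ≡⟨ cong (_+ x) (sum-tabulate-bump m g b off-b at-b′) ⟩
  sum (tabulate g) + y + x       ≡⟨ xy∙z≈xz∙y _ y x ⟩
  sum (tabulate g) + x + y       ≡⟨ +-assoc _ x y ⟩
  sum (tabulate g) + (x + y)     ∎
  where
  open ≡-Reasoning
  m : Fin _ → ℕ
  m = updateAt f a (const (g a))
  off-a : ∀ v → v ≢ a → f v ≡ m v
  off-a v v≢a = sym (updateAt-minimal v a f v≢a)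
  at-a′ : f a ≡ m a + x
  at-a′ = trans at-a (cong (_+ x) (sym (updateAt-updates a f)))
  at-b′ : m b ≡ g b + y
  at-b′ = trans (updateAt-minimal b a f (a≢b ∘ sym)) at-b
  off-b : ∀ v → v ≢ b → m v ≡ g v
  off-b v v≢b with v ≟ a
  ... | yes refl = updateAt-updates v f
  ... | no v≢a = trans (updateAt-minimal v a f v≢a) (off v v≢a v≢b)

sum-tabulate-zeroAt : ∀ {n} (g : Fin n → ℕ) (a : Fin n) →
                      sum (tabulate g) ≡ sum (tabulate (updateAt g a (const 0))) + g a
sum-tabulate-zeroAt g a = sum-tabulate-bump g _ a
  (λ v v≢a → sym (updateAt-minimal v a g v≢a)) (cong (_+ g a) (sym (updateAt-updates a g)))

three-≤-sum-tabulate : ∀ {n} (g : Fin n → ℕ) {a b c : Fin n} → a ≢ b → a ≢ c → b ≢ c →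
                       g a + g b + g c ≤ sum (tabulate g)
three-≤-sum-tabulate g {a} {b} {c} a≢b a≢c b≢c = begin
  g a + g b + g c                ≡⟨ xy∙z≈zy∙x (g a) (g b) (g c) ⟩
  g c + g b + g a                ≤⟨ +-monoˡ-≤ (g a) (+-monoˡ-≤ (g b) gc≤sum-g₂) ⟩
  sum (tabulate g₂) + g b + g a  ≡⟨ cong (_+ g a) sum-g₁ ⟨
  sum (tabulate g₁) + g a        ≡⟨ sum-tabulate-zeroAt g a ⟨
  sum (tabulate g)               ∎
  where
  open ≤-Reasoning
  g₁ g₂ : Fin _ → ℕ
  g₁ = updateAt g a (const 0)
  g₂ = updateAt g₁ b (const 0)
  sum-g₁ : sum (tabulate g₁) ≡ sum (tabulate g₂) + g b
  sum-g₁ = trans (sum-tabulate-zeroAt g₁ b)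
                 (cong (sum (tabulate g₂) +_) (updateAt-minimal b a g (a≢b ∘ sym)))
  gc≤sum-g₂ : g c ≤ sum (tabulate g₂)
  gc≤sum-g₂ = begin
    g c                                              ≡⟨ g₂c≡gc ⟨
    g₂ c                                             ≤⟨ m≤n+m (g₂ c) _ ⟩
    sum (tabulate (updateAt g₂ c (const 0))) + g₂ c  ≡⟨ sum-tabulate-zeroAt g₂ c ⟨
    sum (tabulate g₂)                                ∎
    where
    g₂c≡gc : g₂ c ≡ g c
    g₂c≡gc = trans (updateAt-minimal c b g₁ (b≢c ∘ sym)) (updateAt-minimal c a g (a≢c ∘ sym))

foldr-⊔-tabulate-lub : ∀ {n} (g : Fin n → ℕ) {m} → (∀ v → g v ≤ m) →
                       foldr _⊔_ 0 (tabulate g) ≤ m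
foldr-⊔-tabulate-lub {zero}  g g≤m = z≤n
foldr-⊔-tabulate-lub {suc n} g g≤m = ⊔-lub (g≤m zero) (foldr-⊔-tabulate-lub (g ∘ suc) (g≤m ∘ suc))

≤-foldr-⊔-tabulate : ∀ {n} (g : Fin n → ℕ) (a : Fin n) → g a ≤ foldr _⊔_ 0 (tabulate g)
≤-foldr-⊔-tabulate g zero    = m≤m⊔n _ _
≤-foldr-⊔-tabulate g (suc a) = ≤-trans (≤-foldr-⊔-tabulate (g ∘ suc) a) (m≤n⊔m _ _)

foldr-⊔-tabulate-two : ∀ {n} (g : Fin n → ℕ) {c b : Fin n} →
                       (∀ v → v ≢ c → v ≢ b → g v ≡ 0) →
                       foldr _⊔_ 0 (tabulate g) ≡ g c ⊔ g b
foldr-⊔-tabulate-two g {c} {b} vanishes = ≤-antisym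
  (foldr-⊔-tabulate-lub g bounded)
  (⊔-lub (≤-foldr-⊔-tabulate g c) (≤-foldr-⊔-tabulate g b))
  where
  bounded : ∀ v → g v ≤ g c ⊔ g b
  bounded v with v ≟ c | v ≟ b
  ... | yes refl | _        = m≤m⊔n _ _
  ... | no _     | yes refl = m≤n⊔m _ _
  ... | no v≢c   | no v≢b   = ≤-trans (≤-reflexive (vanishes v v≢c v≢b)) z≤n

EdgeSet : ℕ → Set
EdgeSet n = Fin n → Fin n → Bool

module _ {n : ℕ} where

  Symmetric : EdgeSet n → Set
  Symmetric F = ∀ u v → F u v ≡ F v u

  _⊆_ : EdgeSet n → EdgeSet n → Set
  F ⊆ G = ∀ {u v} → F u v ≡ true → G u v ≡ true

  ⌊≟⌋-refl : (a : Fin n) → ⌊ a ≟ a ⌋ ≡ true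
  ⌊≟⌋-refl a = trans (isYes≗does (a ≟ a)) (dec-true (a ≟ a) refl)

  isEdge-forward : (a b : Fin n) → isEdge a b a b ≡ true
  isEdge-forward a b rewrite ⌊≟⌋-refl a | ⌊≟⌋-refl b = refl

  isEdge-sym : (a b u v : Fin n) → isEdge a b u v ≡ isEdge a b v u
  isEdge-sym a b u v =
    trans (cong₂ _∨_ (∧-comm ⌊ u ≟ a ⌋ ⌊ v ≟ b ⌋) (∧-comm ⌊ u ≟ b ⌋ ⌊ v ≟ a ⌋))
          (∨-comm (⌊ v ≟ b ⌋ ∧ ⌊ u ≟ a ⌋) _)

  isEdge-comm : (a b u v : Fin n) → isEdge a b u v ≡ isEdge b a u v
  isEdge-comm a b u v = ∨-comm (⌊ u ≟ a ⌋ ∧ ⌊ v ≟ b ⌋) _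

  isEdge-true : (a b u v : Fin n) → isEdge a b u v ≡ true → (u ≡ a × v ≡ b) ⊎ (u ≡ b × v ≡ a)
  isEdge-true a b u v with u ≟ a | v ≟ b | u ≟ b | v ≟ a
  ... | yes u≡a | yes v≡b | _       | _       = λ _ → inj₁ (u≡a , v≡b)
  ... | _       | _       | yes u≡b | yes v≡a = λ _ → inj₂ (u≡b , v≡a)
  ... | yes _   | no _    | yes _   | no _    = λ ()
  ... | yes _   | no _    | no _    | _       = λ ()
  ... | no _    | _       | yes _   | no _    = λ ()
  ... | no _    | _       | no _    | _       = λ ()

  isEdge-false : (a b u v : Fin n) → ¬ ((u ≡ a × v ≡ b) ⊎ (u ≡ b × v ≡ a)) →
                 isEdge a b u v ≡ false
  isEdge-false a b u v ¬uv≡ab with isEdge a b u v in uv≡ab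
  ... | false = refl
  ... | true  = ⊥-elim (¬uv≡ab (isEdge-true a b u v uv≡ab))

  removeEdge : EdgeSet n → Fin n → Fin n → EdgeSet n
  removeEdge F a b u v = if isEdge a b u v then false else F u v

  addEdge : EdgeSet n → Fin n → Fin n → EdgeSet n
  addEdge F a b u v = if isEdge a b u v then true else F u v

  removeEdge-removes : ∀ F (a b : Fin n) → removeEdge F a b a b ≡ false
  removeEdge-removes F a b = cong (if_then false else F a b) (isEdge-forward a b)

  removeEdge-keeps : ∀ F {a b u v : Fin n} → isEdge a b u v ≡ false → removeEdge F a b u v ≡ F u v
  removeEdge-keeps F {u = u} {v} uv≢ab = cong (if_then false else F u v) uv≢ab

  removeEdge-⊆ : ∀ F {a b : Fin n} → removeEdge F a b ⊆ F
  removeEdge-⊆ F {a} {b} {u} {v} with isEdge a b u v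
  ... | false = id
  ... | true  = λ ()

  removeEdge-mono : ∀ {F G} (a b : Fin n) → F ⊆ G → removeEdge F a b ⊆ removeEdge G a b
  removeEdge-mono a b F⊆G {u} {v} with isEdge a b u v
  ... | false = F⊆G
  ... | true  = id

  removeEdge-false : ∀ F {a b u v : Fin n} → F u v ≡ false → removeEdge F a b u v ≡ false
  removeEdge-false F {a} {b} {u} {v} Fuv with isEdge a b u v
  ... | false = Fuv
  ... | true  = refl

  removeEdge-comm : ∀ F (a b u v : Fin n) → removeEdge F a b u v ≡ removeEdge F b a u v
  removeEdge-comm F a b u v = cong (if_then false else F u v) (isEdge-comm a b u v)

  removeEdge-sym : ∀ {F} (a b : Fin n) → Symmetric F → Symmetric (removeEdge F a b)
  removeEdge-sym a b F-sym u v rewrite isEdge-sym a b u v | F-sym u v = refl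

  addEdge-adds : ∀ F (a b : Fin n) → addEdge F a b a b ≡ true
  addEdge-adds F a b = cong (if_then true else F a b) (isEdge-forward a b)

  addEdge-⊇ : ∀ F {a b : Fin n} → F ⊆ addEdge F a b
  addEdge-⊇ F {a} {b} {u} {v} with isEdge a b u v
  ... | false = id
  ... | true  = const refl

  addEdge-sym : ∀ {F} (a b : Fin n) → Symmetric F → Symmetric (addEdge F a b)
  addEdge-sym a b F-sym u v rewrite isEdge-sym a b u v | F-sym u v = refl

  removeEdge-addEdge : ∀ {F} {a b : Fin n} → Symmetric F → F a b ≡ false →
                       ∀ u v → removeEdge (addEdge F a b) a b u v ≡ F u v
  removeEdge-addEdge {F} {a} {b} F-sym Fab u v with isEdge a b u v in uv≡ab
  ... | false = refl
  ... | true with isEdge-true a b u v uv≡ab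
  ...   | inj₁ (refl , refl) = sym Fab
  ...   | inj₂ (refl , refl) = sym (trans (F-sym u v) Fab)

  reachable-trans : ∀ {F : EdgeSet n} {x y z} → Reachable F x y → Reachable F y z → Reachable F x z
  reachable-trans here       q = q
  reachable-trans (step e r) q = step e (reachable-trans r q)

  reachable-bind : ∀ {F G : EdgeSet n} → (∀ {u v} → F u v ≡ true → Reachable G u v) →
                   ∀ {x y} → Reachable F x y → Reachable G x y
  reachable-bind edge here       = here
  reachable-bind edge (step e r) = reachable-trans (edge e) (reachable-bind edge r)

  reachable-mono : ∀ {F G : EdgeSet n} → F ⊆ G → ∀ {x y} → Reachable F x y → Reachable G x y
  reachable-mono F⊆G = reachable-bind (λ e → step (F⊆G e) here)

  reachable-reverse : ∀ {F : EdgeSet n} → Symmetric F → ∀ {x y} → Reachable F x y → Reachable F y x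
  reachable-reverse F-sym here       = here
  reachable-reverse F-sym (step e r) =
    reachable-trans (reachable-reverse F-sym r) (step (trans (F-sym _ _) e) here)

  ReachableAcross : EdgeSet n → Fin n → Fin n → Fin n → Fin n → Set
  ReachableAcross G a b x y =
    Reachable G x y ⊎ (Reachable G x a × Reachable G b y) ⊎ (Reachable G x b × Reachable G a y)

  reachableAcross-step : ∀ {G : EdgeSet n} {a b x z y} → G x z ≡ true →
                         ReachableAcross G a b z y → ReachableAcross G a b x y
  reachableAcross-step e (inj₁ r)               = inj₁ (step e r)
  reachableAcross-step e (inj₂ (inj₁ (r , s))) = inj₂ (inj₁ (step e r , s))
  reachableAcross-step e (inj₂ (inj₂ (r , s))) = inj₂ (inj₂ (step e r , s))

  reachable-removeEdge : ∀ {F : EdgeSet n} {a b x y} → Reachable F x y →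
                         ReachableAcross (removeEdge F a b) a b x y
  reachable-removeEdge here = inj₁ here
  reachable-removeEdge {F} {a} {b} {x} (step {v = z} e r) with isEdge a b x z in xz≡ab
  ... | false = reachableAcross-step (trans (removeEdge-keeps F xz≡ab) e) (reachable-removeEdge r)
  ... | true with isEdge-true a b x z xz≡ab | reachable-removeEdge {a = a} {b} r
  ...   | inj₁ (refl , refl) | inj₁ r′               = inj₂ (inj₁ (here , r′))
  ...   | inj₁ (refl , refl) | inj₂ (inj₁ (_ , r′)) = inj₂ (inj₁ (here , r′))
  ...   | inj₁ (refl , refl) | inj₂ (inj₂ (_ , r′)) = inj₁ r′
  ...   | inj₂ (refl , refl) | inj₁ r′               = inj₂ (inj₂ (here , r′))
  ...   | inj₂ (refl , refl) | inj₂ (inj₁ (_ , r′)) = inj₁ r′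
  ...   | inj₂ (refl , refl) | inj₂ (inj₂ (_ , r′)) = inj₂ (inj₂ (here , r′))

  degree-two-neighbours : ∀ (E : EdgeSet n) {v a b y} → deg E v ≡ 2 → a ≢ b →
                          E v a ≡ true → E v b ≡ true → E v y ≡ true → y ≡ a ⊎ y ≡ b
  degree-two-neighbours E {v} {a} {b} {y} deg≡2 a≢b Eva Evb Evy with y ≟ a | y ≟ b
  ... | yes y≡a | _       = inj₁ y≡a
  ... | no _    | yes y≡b = inj₂ y≡b
  ... | no y≢a  | no y≢b  = ⊥-elim (<⇒≱ (s≤s (s≤s (s≤s z≤n))) three≤deg)
    where
    indicator : Fin n → ℕ
    indicator u = if E v u then 1 else 0
    three≤deg : 3 ≤ 2
    three≤deg = begin
      3                                        ≡⟨ cong₂ _+_ (cong₂ _+_ (counts Eva) (counts Evb)) (counts Evy) ⟨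
      indicator a + indicator b + indicator y  ≤⟨ three-≤-sum-tabulate indicator a≢b y≢a′ y≢b′ ⟩
      sum (tabulate indicator)                 ≡⟨ cong sum (map-tabulate id indicator) ⟨
      deg E v                                  ≡⟨ deg≡2 ⟩
      2                                        ∎
      where
      open ≤-Reasoning
      y≢a′ = y≢a ∘ sym
      y≢b′ = y≢b ∘ sym
      counts : ∀ {u} → E v u ≡ true → indicator u ≡ 1
      counts Evu = cong (if_then 1 else 0) Evu

  module _ (w : Fin n → Fin n → ℕ) where

    maxIncident-cong : ∀ F G v → (∀ u → F v u ≡ G v u) → maxIncident w F v ≡ maxIncident w G v
    maxIncident-cong F G v F≗G =
      cong (foldr _⊔_ 0) (map-cong (λ u → cong (if_then w v u else 0) (F≗G u)) (allFin n))

    maxIncident-two : ∀ F {v c b} → (∀ u → F v u ≡ true → u ≡ c ⊎ u ≡ b) →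
                      maxIncident w F v ≡ (if F v c then w v c else 0) ⊔ (if F v b then w v b else 0)
    maxIncident-two F {v} {c} {b} nbrs =
      trans (cong (foldr _⊔_ 0) (map-tabulate id row)) (foldr-⊔-tabulate-two row vanishes)
      where
      row : Fin n → ℕ
      row u = if F v u then w v u else 0
      vanishes : ∀ u → u ≢ c → u ≢ b → row u ≡ 0
      vanishes u u≢c u≢b with F v u in Fvu
      ... | false = refl
      ... | true  = ⊥-elim ([ u≢c , u≢b ]′ (nbrs u Fvu))

    module _ (ℓ : Fin n → ℕ) where

      power : EdgeSet n → Fin n → ℕ
      power F v = ℓ v ⊔ maxIncident w F v

      cost≡sum-power : ∀ F → cost w ℓ F ≡ sum (tabulate (power F))
      cost≡sum-power F = cong sum (map-tabulate id (power F))

      cost-cong : ∀ F G → (∀ u v → F u v ≡ G u v) → cost w ℓ F ≡ cost w ℓ G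
      cost-cong F G F≗G = begin
        cost w ℓ F                ≡⟨ cost≡sum-power F ⟩
        sum (tabulate (power F))  ≡⟨ sum-tabulate-cong power-F≗G ⟩
        sum (tabulate (power G))  ≡⟨ cost≡sum-power G ⟨
        cost w ℓ G                ∎
        where
        open ≡-Reasoning
        power-F≗G : ∀ v → power F v ≡ power G v
        power-F≗G v = cong (ℓ v ⊔_) (maxIncident-cong F G v (F≗G v))

      power-removeEdge : ∀ H {a b c} → c ≢ b → H a c ≡ true → H a b ≡ true →
                         (∀ u → H a u ≡ true → u ≡ c ⊎ u ≡ b) →
                         power H a ≡ power (removeEdge H a b) a + (w a b ∸ (ℓ a ⊔ w a c))
      power-removeEdge H {a} {b} {c} c≢b Hac Hab nbrs = begin
        ℓ a ⊔ maxIncident w H a                ≡⟨ cong (ℓ a ⊔_) max-H ⟩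
        ℓ a ⊔ (w a c ⊔ w a b)                  ≡⟨ ⊔-assoc (ℓ a) _ _ ⟨
        ℓ a ⊔ w a c ⊔ w a b                    ≡⟨ m⊔n≡m+[n∸m] (ℓ a ⊔ w a c) (w a b) ⟩
        ℓ a ⊔ w a c + (w a b ∸ (ℓ a ⊔ w a c))  ≡⟨ cong (λ m → ℓ a ⊔ m + _) max-H′ ⟨
        power H′ a + (w a b ∸ (ℓ a ⊔ w a c))   ∎
        where
        open ≡-Reasoning
        H′ = removeEdge H a b
        H′ac : H′ a c ≡ true
        H′ac = trans (removeEdge-keeps H (isEdge-false a b a c ac≢ab)) Hac
          where
          ac≢ab : ¬ ((a ≡ a × c ≡ b) ⊎ (a ≡ b × c ≡ a))
          ac≢ab (inj₁ (_ , c≡b))   = c≢b c≡b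
          ac≢ab (inj₂ (a≡b , c≡a)) = c≢b (trans c≡a a≡b)
        max-H : maxIncident w H a ≡ w a c ⊔ w a b
        max-H = trans (maxIncident-two H nbrs) (cong₂ _⊔_ (cong (if_then w a c else 0) Hac)
                                                          (cong (if_then w a b else 0) Hab))
        max-H′ : maxIncident w H′ a ≡ w a c
        max-H′ = begin
          maxIncident w H′ a  ≡⟨ maxIncident-two H′ (λ u e → nbrs u (removeEdge-⊆ H e)) ⟩
          (if H′ a c then w a c else 0) ⊔ (if H′ a b then w a b else 0)
            ≡⟨ cong₂ _⊔_ (cong (if_then w a c else 0) H′ac)
                         (cong (if_then w a b else 0) (removeEdge-removes H a b)) ⟩
          w a c ⊔ 0           ≡⟨ ⊔-identityʳ (w a c) ⟩
          w a c               ∎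

      cost-removeEdge : ∀ H {a b x y} → a ≢ b →
                        power H a ≡ power (removeEdge H a b) a + x →
                        power H b ≡ power (removeEdge H a b) b + y →
                        cost w ℓ H ≡ cost w ℓ (removeEdge H a b) + (x + y)
      cost-removeEdge H {a} {b} a≢b at-a at-b = begin
        cost w ℓ H                              ≡⟨ cost≡sum-power H ⟩
        sum (tabulate (power H))                ≡⟨ sum-tabulate-bump₂ _ _ a≢b elsewhere at-a at-b ⟩
        sum (tabulate (power H′)) + _           ≡⟨ cong (_+ _) (cost≡sum-power H′) ⟨
        cost w ℓ H′ + _                         ∎
        where
        open ≡-Reasoning
        H′ = removeEdge H a b
        elsewhere : ∀ v → v ≢ a → v ≢ b → power H v ≡ power H′ v
        elsewhere v v≢a v≢b = cong (ℓ v ⊔_) (maxIncident-cong H H′ v λ u →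
          sym (removeEdge-keeps H (isEdge-false a b v u [ v≢a ∘ proj₁ , v≢b ∘ proj₁ ]′)))

module OnPath {n} {E : EdgeSet n} (E-sym : Symmetric E) {h : ℕ} {p : ℕ → Fin n}
  (path-edge : ∀ j → j < h → E (p j) (p (suc j)) ≡ true)
  (p-injective : ∀ j j′ → j ≤ h → j′ ≤ h → p j ≡ p j′ → j ≡ j′)
  (interior-deg : ∀ j → 1 ≤ j → j ≤ h ∸ 1 → deg E (p j) ≡ 2)
  where

  p-≢ : ∀ {j j′} → j ≤ h → j′ ≤ h → j ≢ j′ → p j ≢ p j′
  p-≢ j≤h j′≤h j≢j′ = j≢j′ ∘ p-injective _ _ j≤h j′≤h

  interior-neighbours : ∀ j → suc (suc j) ≤ h → ∀ {y} → E (p (suc j)) y ≡ true →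
                        y ≡ p j ⊎ y ≡ p (suc (suc j))
  interior-neighbours j 2+j≤h = degree-two-neighbours E
    (interior-deg (suc j) (s≤s z≤n) (∸-monoˡ-≤ 1 2+j≤h))
    (p-≢ (<⇒≤ j<h) 2+j≤h (m≢1+n+m j))
    (trans (E-sym _ _) (path-edge j j<h))
    (path-edge (suc j) 2+j≤h)
    where
    j<h : j < h
    j<h = <⇒≤ 2+j≤h

  InSegment : ℕ → ℕ → Fin n → Set
  InSegment lo hi x = ∃[ j ] (lo < j × j ≤ hi × p j ≡ x)

  segment-closed : ∀ {G lo hi} → G ⊆ E → hi < h →
                   G (p (suc lo)) (p lo) ≡ false → G (p hi) (p (suc hi)) ≡ false →
                   ∀ {x y} → Reachable G x y → InSegment lo hi x → InSegment lo hi y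
  segment-closed G⊆E hi<h lo-cut hi-cut here x∈ = x∈
  segment-closed G⊆E hi<h lo-cut hi-cut (step e r) (zero , () , _)
  segment-closed {lo = lo} {hi} G⊆E hi<h lo-cut hi-cut (step {v = y} e r) (suc j , lo<1+j , 1+j≤hi , refl) =
    segment-closed G⊆E hi<h lo-cut hi-cut r y∈
    where
    y∈ : InSegment lo hi y
    y∈ with interior-neighbours j (≤-trans (s≤s 1+j≤hi) hi<h) (G⊆E e)
    ... | inj₁ refl with j ≟ℕ lo
    ...   | yes refl = contradiction (trans (sym e) lo-cut) λ ()
    ...   | no j≢lo  = j , ≤∧≢⇒< (≤-pred lo<1+j) (j≢lo ∘ sym) , <⇒≤ 1+j≤hi , refl
    y∈ | inj₂ refl with suc j ≟ℕ hi
    ...   | yes refl  = contradiction (trans (sym e) hi-cut) λ ()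
    ...   | no 1+j≢hi = suc (suc j) , m<n⇒m<1+n lo<1+j , ≤∧≢⇒< 1+j≤hi 1+j≢hi , refl

  lower-end-unreachable : ∀ {G lo hi} → G ⊆ E → lo < hi → hi < h →
                          G (p (suc lo)) (p lo) ≡ false → G (p hi) (p (suc hi)) ≡ false →
                          ¬ Reachable G (p (suc lo)) (p lo)
  lower-end-unreachable {lo = lo} G⊆E lo<hi hi<h lo-cut hi-cut r
    with segment-closed G⊆E hi<h lo-cut hi-cut r (suc lo , ≤-refl , lo<hi , refl)
  ... | j , lo<j , j≤hi , pj≡plo =
    <⇒≢ lo<j (sym (p-injective j lo (≤-trans j≤hi (<⇒≤ hi<h)) (<⇒≤ (<-trans lo<hi hi<h)) pj≡plo))

  upper-end-unreachable : ∀ {G lo hi} → G ⊆ E → lo < hi → hi < h →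
                          G (p (suc lo)) (p lo) ≡ false → G (p hi) (p (suc hi)) ≡ false →
                          ¬ Reachable G (p hi) (p (suc hi))
  upper-end-unreachable {hi = hi} G⊆E lo<hi hi<h lo-cut hi-cut r
    with segment-closed G⊆E hi<h lo-cut hi-cut r (hi , lo<hi , ≤-refl , refl)
  ... | j , _ , j≤hi , pj≡p1+hi =
    1+n≰n (subst (_≤ hi) (p-injective j (suc hi) (≤-trans j≤hi (<⇒≤ hi<h)) hi<h pj≡p1+hi) j≤hi)

  cost-removePathEdge : ∀ w ℓ → (∀ u v → w u v ≡ w v u) → ∀ {H} → Symmetric H → H ⊆ E →
                        (∀ j → j < h → H (p j) (p (suc j)) ≡ true) → ∀ j → 1 ≤ j → j + 2 ≤ h →
                        cost w ℓ H ≡ cost w ℓ (removeEdge H (p j) (p (suc j))) + β w ℓ p j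
  cost-removePathEdge w ℓ w-sym {H} H-sym H⊆E H-path (suc j) _ 1+j+2≤h = begin
    cost w ℓ H
      ≡⟨ cost-removeEdge w ℓ H (p-≢ 1+j≤h 2+j≤h (m≢1+n+m (suc j) {0})) at-a at-b ⟩
    cost w ℓ H′ + ((w a b ∸ (ℓ a ⊔ w a c)) + (w b a ∸ (ℓ b ⊔ w b e)))
      ≡⟨ cong (cost w ℓ H′ +_) (cong₂ _+_ (cong (λ m → w a b ∸ (ℓ a ⊔ m)) (w-sym a c))
                                          (cong (_∸ (ℓ b ⊔ w b e)) (w-sym b a))) ⟩
    cost w ℓ H′ + β w ℓ p (suc j) ∎
    where
    open ≡-Reasoning
    a = p (suc j)
    b = p (suc (suc j))
    c = p j
    e = p (suc (suc (suc j)))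
    H′ = removeEdge H a b
    3+j≤h : suc (suc (suc j)) ≤ h
    3+j≤h = subst (_≤ h) (+-comm (suc j) 2) 1+j+2≤h
    2+j≤h : suc (suc j) ≤ h
    2+j≤h = <⇒≤ 3+j≤h
    1+j≤h : suc j ≤ h
    1+j≤h = <⇒≤ 2+j≤h
    at-a : power w ℓ H a ≡ power w ℓ H′ a + (w a b ∸ (ℓ a ⊔ w a c))
    at-a = power-removeEdge w ℓ H (p-≢ (<⇒≤ 1+j≤h) 2+j≤h (m≢1+n+m j))
             (trans (H-sym a c) (H-path j 1+j≤h)) (H-path (suc j) 2+j≤h)
             (λ u Hau → interior-neighbours j 2+j≤h (H⊆E Hau))
    at-b : power w ℓ H b ≡ power w ℓ H′ b + (w b a ∸ (ℓ b ⊔ w b e))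
    at-b = trans
      (power-removeEdge w ℓ H (p-≢ 3+j≤h 1+j≤h (m≢1+n+m (suc j) {1} ∘ sym))
        (H-path (suc (suc j)) 3+j≤h) (trans (H-sym b a) (H-path (suc j) 2+j≤h))
        (λ u Hbu → swap (interior-neighbours (suc j) 3+j≤h (H⊆E Hbu))))
      (cong (λ m → ℓ b ⊔ m + (w b a ∸ (ℓ b ⊔ w b e)))
            (maxIncident-cong w (removeEdge H b a) H′ b (removeEdge-comm H b a b)))

  module Exchange {F : EdgeSet n} (F-sym : Symmetric F) (F⊆E : F ⊆ E) (F-connected : Connected F)
                  {k} (k<h : k < h) (Fk : F (p k) (p (suc k)) ≡ false)
    where

    F-path : ∀ j → j < h → j ≢ k → F (p j) (p (suc j)) ≡ true
    F-path j j<h j≢k with F (p j) (p (suc j)) in Fj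
    ... | true  = refl
    ... | false with <-cmp j k
    ...   | tri< j<k _ _ =
      ⊥-elim (lower-end-unreachable F⊆E j<k k<h (trans (F-sym _ _) Fj) Fk (F-connected _ _))
    ...   | tri≈ _ j≡k _ = ⊥-elim (j≢k j≡k)
    ...   | tri> _ _ k<j =
      ⊥-elim (lower-end-unreachable F⊆E k<j j<h (trans (F-sym _ _) Fk) Fj (F-connected _ _))

    F⁺ : EdgeSet n
    F⁺ = addEdge F (p k) (p (suc k))

    F⁺-sym : Symmetric F⁺
    F⁺-sym = addEdge-sym (p k) (p (suc k)) F-sym

    F⁺⊆E : F⁺ ⊆ E
    F⁺⊆E {u} {v} with isEdge (p k) (p (suc k)) u v in uv≡k
    ... | false = F⊆E
    ... | true with isEdge-true _ _ u v uv≡k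
    ...   | inj₁ (refl , refl) = const (path-edge k k<h)
    ...   | inj₂ (refl , refl) = const (trans (E-sym _ _) (path-edge k k<h))

    F⁺-path : ∀ j → j < h → F⁺ (p j) (p (suc j)) ≡ true
    F⁺-path j j<h with j ≟ℕ k
    ... | yes refl = addEdge-adds F (p k) (p (suc k))
    ... | no j≢k   = addEdge-⊇ F (F-path j j<h j≢k)

    exchange-cost : ∀ w ℓ → (∀ u v → w u v ≡ w v u) → 1 ≤ k → k + 2 ≤ h →
                    ∀ {i} → 1 ≤ i → i + 2 ≤ h →
                    cost w ℓ (removeEdge F⁺ (p i) (p (suc i))) + β w ℓ p i ≡ cost w ℓ F + β w ℓ p k
    exchange-cost w ℓ w-sym 1≤k k+2≤h {i} 1≤i i+2≤h = begin
      cost w ℓ (removeEdge F⁺ (p i) (p (suc i))) + β w ℓ p i  ≡⟨ removing i 1≤i i+2≤h ⟨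
      cost w ℓ F⁺                                              ≡⟨ removing k 1≤k k+2≤h ⟩
      cost w ℓ (removeEdge F⁺ (p k) (p (suc k))) + β w ℓ p k  ≡⟨ cong (_+ β w ℓ p k) F⁺-k≡F ⟩
      cost w ℓ F + β w ℓ p k                                  ∎
      where
      open ≡-Reasoning
      removing = cost-removePathEdge w ℓ w-sym F⁺-sym F⁺⊆E F⁺-path
      F⁺-k≡F = cost-cong w ℓ _ F (removeEdge-addEdge F-sym Fk)

    exchange-connected : ∀ {i} → i < h → Connected (removeEdge F⁺ (p i) (p (suc i)))
    exchange-connected {i} i<h x y = reachable-bind F-edge (F-connected x y)
      where
      a = p i
      b = p (suc i)
      c = p k
      d = p (suc k)
      T = removeEdge F⁺ a b
      G = removeEdge F a b
      T-sym : Symmetric T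
      T-sym = removeEdge-sym a b F⁺-sym
      G-sym : Symmetric G
      G-sym = removeEdge-sym a b F-sym
      G⊆E : G ⊆ E
      G⊆E = F⊆E ∘ removeEdge-⊆ F
      lift : ∀ {u v} → Reachable G u v → Reachable T u v
      lift = reachable-mono {F = G} {G = T} (removeEdge-mono {F = F} {G = F⁺} a b (addEdge-⊇ F))
      back : ∀ {u v} → Reachable T u v → Reachable T v u
      back = reachable-reverse T-sym

      i≢k : F a b ≡ true → i ≢ k
      i≢k Fab refl = contradiction (trans (sym Fab) Fk) λ ()

      Tcd : i ≢ k → T c d ≡ true
      Tcd i≢k = trans (removeEdge-keeps F⁺ (isEdge-false a b c d distinct)) (addEdge-adds F c d)
        where
        distinct : ¬ ((c ≡ a × d ≡ b) ⊎ (c ≡ b × d ≡ a))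
        distinct (inj₁ (c≡a , _))     = i≢k (sym (p-injective k i (<⇒≤ k<h) (<⇒≤ i<h) c≡a))
        distinct (inj₂ (c≡b , d≡a)) = m≢1+n+m i {1} (begin
          i          ≡⟨ p-injective (suc k) i k<h (<⇒≤ i<h) d≡a ⟨
          suc k      ≡⟨ cong suc (p-injective k (suc i) (<⇒≤ k<h) i<h c≡b) ⟩
          suc (suc i) ∎)
          where open ≡-Reasoning

      c↛d : i ≢ k → ¬ Reachable G c d
      c↛d i≢k with <-cmp i k
      ... | tri< i<k _ _ = upper-end-unreachable G⊆E i<k k<h
                             (trans (removeEdge-comm F a b b a) (removeEdge-removes F b a))
                             (removeEdge-false F Fk)
      ... | tri≈ _ i≡k _ = ⊥-elim (i≢k i≡k)
      ... | tri> _ _ k<i = lower-end-unreachable G⊆E k<i i<h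
                             (removeEdge-false F (trans (F-sym d c) Fk)) (removeEdge-removes F a b)
                           ∘ reachable-reverse G-sym

      route : i ≢ k → Reachable T a b
      route i≢k with reachable-removeEdge {a = a} {b} (F-connected c d)
      ... | inj₁ c~d                = ⊥-elim (c↛d i≢k c~d)
      ... | inj₂ (inj₁ (c~a , b~d)) =
        reachable-trans (back (lift c~a)) (step (Tcd i≢k) (back (lift b~d)))
      ... | inj₂ (inj₂ (c~b , a~d)) =
        reachable-trans (lift a~d) (step (trans (T-sym d c) (Tcd i≢k)) (lift c~b))

      F-edge : ∀ {u v} → F u v ≡ true → Reachable T u v
      F-edge {u} {v} Fuv with isEdge a b u v in uv≡ab
      ... | false = step (trans (removeEdge-keeps F⁺ uv≡ab) (addEdge-⊇ F Fuv)) here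
      ... | true with isEdge-true a b u v uv≡ab
      ...   | inj₁ (refl , refl) = route (i≢k Fuv)
      ...   | inj₂ (refl , refl) = back (route (i≢k (trans (F-sym a b) Fuv)))

lemma5 : (n : ℕ) (E : Fin n → Fin n → Bool) (w : Fin n → Fin n → ℕ) (ℓ : Fin n → ℕ) →
    IsSimpleGraph E → Connected E → ((u v : Fin n) → w u v ≡ w v u) →
    (h : ℕ) (p : ℕ → Fin n) → IsPath E p h → 8 < h →
    2 < deg E (p 0) → 2 < deg E (p h) →
    ((j : ℕ) → 1 ≤ j → j ≤ h ∸ 1 → deg E (p j) ≡ 2) →
    (i k : ℕ) → 1 ≤ i → i + 2 ≤ h → 1 ≤ k → k + 2 ≤ h →
    β w ℓ p k ≤ β w ℓ p i →
    (F : Fin n → Fin n → Bool) → IsOptimal E w ℓ F → F (p k) (p (suc k)) ≡ false →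
    IsConnSpanningSubgraph E (swapEdge F (p i) (p (suc i)) (p k) (p (suc k))) ×
    cost w ℓ (swapEdge F (p i) (p (suc i)) (p k) (p (suc k))) ≤ cost w ℓ F
lemma5 n E w ℓ (E-sym , _) _ w-sym h p (path-edge , p-injective) _ _ _ interior-deg
       i k 1≤i i+2≤h 1≤k k+2≤h βk≤βi F ((F-sym , F⊆E , F-connected) , _) Fk =
  (removeEdge-sym (p i) (p (suc i)) F⁺-sym , (λ _ _ → F⁺⊆E ∘ removeEdge-⊆ F⁺) ,
   exchange-connected (+2≤⇒< i+2≤h)) ,
  +-cancelʳ-≤ (β w ℓ p i) _ _ (begin
    cost w ℓ T + β w ℓ p i  ≡⟨ exchange-cost w ℓ w-sym 1≤k k+2≤h 1≤i i+2≤h ⟩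
    cost w ℓ F + β w ℓ p k  ≤⟨ +-monoʳ-≤ (cost w ℓ F) βk≤βi ⟩
    cost w ℓ F + β w ℓ p i  ∎)
  where
  +2≤⇒< : ∀ {j} → j + 2 ≤ h → j < h
  +2≤⇒< {j} j+2≤h = <⇒≤ (subst (_≤ h) (+-comm j 2) j+2≤h)
  open OnPath E-sym path-edge p-injective interior-deg
  open Exchange F-sym (F⊆E _ _) F-connected (+2≤⇒< k+2≤h) Fk
  open ≤-Reasoning
  T = removeEdge F⁺ (p i) (p (suc i))
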